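{- Let $\mathcal L=\{R,G,X,Y\}$, $S=\{RRX, RXX, RYY, GYX, GXX, YYX, XXX\}$, $\mathcal L'=\{G,R,Y\}$ with order $G>R>Y$, and let $\mathcal M_S$ be the Fraïssé limit of $Forb_c(S)$. Let $a,b,c\in\mathcal M_S$ and $B\subseteq\mathcal M_S$ finite such that $\mathbf r(a,b),\mathbf r(b,c)\in\mathcal L'$ and $a\mathrel{\perp\!\!\!\perp}_{bB}c$. Then $a\mathrel{\perp\!\!\!\perp}_B c$.
   Context: The relations of $\mathcal L$ are binary, symmetric and irreflexive; a structure is complete if any two distinct elements $a,b$ are related by exactly one relation, denoted $\mathbf r(a,b)$. A triangle is a complete structure on three points, specified by the multiset of its edge relations. $Forb_c(S)$ is the class of finite complete structures embedding no triangle of $S$; it is an amalgamation class and $\mathcal M_S$ is its Fraïssé limit (countable homogeneous structure with age $Forb_c(S)$). For $B\subseteq A,C$ in $Forb_c(S)$, $A\otimes_B C$ is the complete structure on the disjoint union of $A,C$ over $B$ extending both, with $\mathbf r(a,c)$ for $a\in A\setminus B$, $c\in C\setminus B$ equal to the first of $G,R,Y$ such that for no $b\in B$ the triangle with edges $\mathbf r(a,b),\mathbf r(b,c),\mathbf r(a,c)$ is in $S$. For finite $A,B,C\subseteq\mathcal M_S$, $A\mathrel{\perp\!\!\!\perp}_B C$ means the substructure on $A\cup B\cup C$ equals $AB\otimes_B BC$, where $AB$ is the substructure on $A\cup B$ and $bB=\{b\}\cup B$. -}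

module Defs where

open import Data.Nat using (ℕ)
open import Data.Fin using (Fin)
open import Data.Product using (Σ; ∃; _×_; _,_)
open import Data.Sum using (_⊎_)
open import Data.List using (List; []; _∷_)
open import Data.List.Relation.Unary.Any using (Any)
open import Data.List.Membership.Propositional using (_∈_; _∉_)
open import Relation.Binary.PropositionalEquality using (_≡_; _≢_)
open import Relation.Nullary using (¬_)

data L : Set where
  R G X Y : L

data InL′ : L → Set where
  inG : InL′ G
  inR : InL′ R
  inY : InL′ Y

-- A triangle is a multiset of three edge relations.
record Tri : Set where
  constructor tri
  field
    e₁ e₂ e₃ : L

data SameMultiset : Tri → Tri → Set where
  p123 : ∀ {x y z} → SameMultiset (tri x y z) (tri x y z)
  p132 : ∀ {x y z} → SameMultiset (tri x y z) (tri x z y)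
  p213 : ∀ {x y z} → SameMultiset (tri x y z) (tri y x z)
  p231 : ∀ {x y z} → SameMultiset (tri x y z) (tri y z x)
  p312 : ∀ {x y z} → SameMultiset (tri x y z) (tri z x y)
  p321 : ∀ {x y z} → SameMultiset (tri x y z) (tri z y x)

S : List Tri
S = tri R R X ∷ tri R X X ∷ tri R Y Y ∷ tri G Y X ∷ tri G X X ∷ tri Y Y X ∷ tri X X X ∷ []

InS : L → L → L → Set
InS x y z = Any (SameMultiset (tri x y z)) S

-- Complete L-structures on ℕ: r a b is the unique relation between
-- distinct a and b (values on the diagonal are irrelevant).

FinForb : (n : ℕ) → (Fin n → Fin n → L) → Set
FinForb n f =
  (∀ i j → i ≢ j → f i j ≡ f j i) ×
  (∀ i j k → i ≢ j → j ≢ k → i ≢ k → ¬ InS (f i j) (f j k) (f i k))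

-- M_S: a countable homogeneous complete structure (on ℕ) whose age is Forb_c(S).
record IsFraisseLimitS (r : ℕ → ℕ → L) : Set where
  field
    symmetric : ∀ a b → a ≢ b → r a b ≡ r b a
    noForbidden : ∀ a b c → a ≢ b → b ≢ c → a ≢ c → ¬ InS (r a b) (r b c) (r a c)
    universal : ∀ (n : ℕ) (f : Fin n → Fin n → L) → FinForb n f →
      Σ (Fin n → ℕ) λ e →
        (∀ i j → e i ≡ e j → i ≡ j) × (∀ i j → i ≢ j → r (e i) (e j) ≡ f i j)
    homogeneous : ∀ (n : ℕ) (g h : Fin n → ℕ) →
      (∀ i j → g i ≡ g j → i ≡ j) →
      (∀ i j → h i ≡ h j → i ≡ j) →
      (∀ i j → i ≢ j → r (g i) (g j) ≡ r (h i) (h j)) →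
      Σ (ℕ → ℕ) λ σ → Σ (ℕ → ℕ) λ τ →
        (∀ x → τ (σ x) ≡ x) × (∀ x → σ (τ x) ≡ x) ×
        (∀ x y → x ≢ y → r (σ x) (σ y) ≡ r x y) ×
        (∀ i → σ (g i) ≡ h i)

Admissible : (ℕ → ℕ → L) → List ℕ → ℕ → ℕ → L → Set
Admissible r B x y ℓ = ∀ d → d ∈ B → ¬ InS (r x d) (r d y) ℓ

IsFirstAdmissible : (ℕ → ℕ → L) → List ℕ → ℕ → ℕ → Set
IsFirstAdmissible r B x y =
  (r x y ≡ G × Admissible r B x y G) ⊎
  (r x y ≡ R × ¬ Admissible r B x y G × Admissible r B x y R) ⊎
  (r x y ≡ Y × ¬ Admissible r B x y G × ¬ Admissible r B x y R × Admissible r B x y Y)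

-- A ⫫_B C : the substructure on A ∪ B ∪ C equals AB ⊗_B BC, i.e.
-- AB and BC intersect exactly in B (A ∩ C ⊆ B) and every cross edge
-- between A∖B and C∖B is given by the ⊗ rule.
Indep : (ℕ → ℕ → L) → List ℕ → List ℕ → List ℕ → Set
Indep r A B C =
  (∀ x → x ∈ A → x ∈ C → x ∈ B) ×
  (∀ x y → x ∈ A → x ∉ B → y ∈ C → y ∉ B → IsFirstAdmissible r B x y)

module Submission where

-- Write ⊗-edges as "first admissible label among G > R > Y".
-- Passing from the base b ∷ B to B can only make labels more admissible,
-- so r(a,c), being first admissible over b ∷ B, stays first admissible
-- over B as soon as (i) G-admissibility over B implies G-admissibility
-- over b ∷ B, and (ii) if neither G nor R is admissible over b ∷ B then R
-- is not admissible over B either.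
--   (i) holds because a triangle of S containing G also contains X, while
--       r(a,b), r(b,c) ∈ L′.
--  (ii) If R were admissible over B, the point b must forbid R, which for
--       labels in L′ forces r(a,b) = r(b,c) = Y (the triangle RYY).  A local
--       check on the triangles abd, cbd of M_S then shows that any d ∈ B
--       forbidding G also forbids R, so G would be admissible over b ∷ B.

open import Defs
open import Data.Nat using (ℕ)
open import Data.Nat.Properties using () renaming (_≟_ to _≟ℕ_)
open import Data.List using (List; []; _∷_)
open import Data.List.Relation.Unary.Any using (here; there; any?; toSum)
open import Data.List.Membership.Propositional using (_∈_; _∉_)
open import Data.Product using (_×_; _,_; proj₁; proj₂)
open import Data.Sum using (inj₁; inj₂; [_,_]′)
open import Relation.Binary.Definitions using (DecidableEquality)
open import Relation.Binary.PropositionalEquality using (_≡_; _≢_; refl; sym; trans; subst; ≢-sym)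
open import Relation.Nullary using (¬_; Dec; yes; no; contradiction)
open import Relation.Nullary.Decidable using (map′; _×-dec_; _→-dec_; ¬?; from-yes)
open import Relation.Unary using (Decidable)
open import Function using (_∘_)

_≟L_ : DecidableEquality L
R ≟L R = yes refl
R ≟L G = no λ ()
R ≟L X = no λ ()
R ≟L Y = no λ ()
G ≟L R = no λ ()
G ≟L G = yes refl
G ≟L X = no λ ()
G ≟L Y = no λ ()
X ≟L R = no λ ()
X ≟L G = no λ ()
X ≟L X = yes refl
X ≟L Y = no λ ()
Y ≟L R = no λ ()
Y ≟L G = no λ ()
Y ≟L X = no λ ()
Y ≟L Y = yes refl

_≟T_ : DecidableEquality Tri
tri x y z ≟T tri u v w =
  map′ (λ { (refl , refl , refl) → refl }) (λ { refl → refl , refl , refl })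
       ((x ≟L u) ×-dec (y ≟L v) ×-dec (z ≟L w))

open import Data.List.Membership.DecPropositional _≟T_ using (_∈?_)

rearrangements : Tri → List Tri
rearrangements (tri x y z) =
  tri x y z ∷ tri x z y ∷ tri y x z ∷ tri y z x ∷ tri z x y ∷ tri z y x ∷ []

sameMultiset⇒rearrangement : ∀ {s t} → SameMultiset s t → t ∈ rearrangements s
sameMultiset⇒rearrangement p123 = here refl
sameMultiset⇒rearrangement p132 = there (here refl)
sameMultiset⇒rearrangement p213 = there (there (here refl))
sameMultiset⇒rearrangement p231 = there (there (there (here refl)))
sameMultiset⇒rearrangement p312 = there (there (there (there (here refl))))
sameMultiset⇒rearrangement p321 = there (there (there (there (there (here refl)))))

rearrangement⇒sameMultiset : ∀ s {t} → t ∈ rearrangements s → SameMultiset s t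
rearrangement⇒sameMultiset (tri x y z) (here refl) = p123
rearrangement⇒sameMultiset (tri x y z) (there (here refl)) = p132
rearrangement⇒sameMultiset (tri x y z) (there (there (here refl))) = p213
rearrangement⇒sameMultiset (tri x y z) (there (there (there (here refl)))) = p231
rearrangement⇒sameMultiset (tri x y z) (there (there (there (there (here refl))))) = p312
rearrangement⇒sameMultiset (tri x y z) (there (there (there (there (there (here refl)))))) = p321

sameMultiset? : ∀ s t → Dec (SameMultiset s t)
sameMultiset? s t =
  map′ (rearrangement⇒sameMultiset s) sameMultiset⇒rearrangement (t ∈? rearrangements s)

-- The decision procedure for the forbidden triangles; it makes the label
-- facts below checkable by evaluation.
InS? : ∀ x y z → Dec (InS x y z)
InS? x y z = any? (sameMultiset? (tri x y z)) S

InL′? : Decidable InL′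
InL′? R = yes inR
InL′? G = yes inG
InL′? X = no λ ()
InL′? Y = yes inY

-- A property of labels holds everywhere iff it holds at R, G, X and Y;
-- this turns statements about finitely many labels into computations.
∀L? : {P : L → Set} → Decidable P → Dec (∀ x → P x)
∀L? P? = map′ (λ { (pR , pG , pX , pY) → λ { R → pR ; G → pG ; X → pX ; Y → pY } })
              (λ p → p R , p G , p X , p Y)
              (P? R ×-dec P? G ×-dec P? X ×-dec P? Y)

-- Every triangle of S with an edge G has an edge X, so two L′-edges never
-- forbid closing with G.
G-unforbidden-on-L′ : ∀ x y → InL′ x → InL′ y → ¬ InS x y G
G-unforbidden-on-L′ =
  from-yes (∀L? λ x → ∀L? λ y → InL′? x →-dec InL′? y →-dec ¬? (InS? x y G))

R-forbidden-on-L′ : ∀ x y → InL′ x → InL′ y → InS x y R → x ≡ Y × y ≡ Y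
R-forbidden-on-L′ =
  from-yes (∀L? λ x → ∀L? λ y →
    InL′? x →-dec InL′? y →-dec InS? x y R →-dec (x ≟L Y) ×-dec (y ≟L Y))

-- Local configuration behind step (ii): let b see a and c by Y and see d by
-- bd.
G-forbidden⇒R-forbidden : ∀ ad dc bd →
  ¬ InS Y bd ad → ¬ InS Y bd dc → InS ad dc G → InS ad dc R
G-forbidden⇒R-forbidden =
  from-yes (∀L? λ ad → ∀L? λ dc → ∀L? λ bd →
    ¬? (InS? Y bd ad) →-dec ¬? (InS? Y bd dc) →-dec InS? ad dc G →-dec InS? ad dc R)

module _ (r : ℕ → ℕ → L) {x y b : ℕ} {B : List ℕ} where

  admissible-drop : ∀ {ℓ} → Admissible r (b ∷ B) x y ℓ → Admissible r B x y ℓ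
  admissible-drop adm d d∈B = adm d (there d∈B)

  admissible-add : ∀ {ℓ} → ¬ InS (r x b) (r b y) ℓ →
    Admissible r B x y ℓ → Admissible r (b ∷ B) x y ℓ
  admissible-add allowed adm d (here refl) = allowed
  admissible-add allowed adm d (there d∈B) = adm d d∈B

  forbidden-at-new-point : ∀ {ℓ} → Admissible r B x y ℓ →
    ¬ Admissible r (b ∷ B) x y ℓ → InS (r x b) (r b y) ℓ
  forbidden-at-new-point {ℓ} adm ¬adm with InS? (r x b) (r b y) ℓ
  ... | yes forbidden = forbidden
  ... | no allowed = contradiction (admissible-add allowed adm) ¬adm

  firstAdmissible-drop :
    (Admissible r B x y G → Admissible r (b ∷ B) x y G) →
    (¬ Admissible r (b ∷ B) x y G → ¬ Admissible r (b ∷ B) x y R →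
       ¬ Admissible r B x y R) →
    IsFirstAdmissible r (b ∷ B) x y → IsFirstAdmissible r B x y
  firstAdmissible-drop liftG dropR (inj₁ (eq , admG)) =
    inj₁ (eq , admissible-drop admG)
  firstAdmissible-drop liftG dropR (inj₂ (inj₁ (eq , ¬admG , admR))) =
    inj₂ (inj₁ (eq , (λ admG → ¬admG (liftG admG)) , admissible-drop admR))
  firstAdmissible-drop liftG dropR (inj₂ (inj₂ (eq , ¬admG , ¬admR , admY))) =
    inj₂ (inj₂ (eq , (λ admG → ¬admG (liftG admG)) , dropR ¬admG ¬admR , admissible-drop admY))

G-admissible-lift : ∀ r {a b c B} → InL′ (r a b) → InL′ (r b c) →
  Admissible r B a c G → Admissible r (b ∷ B) a c G
G-admissible-lift r ab∈L′ bc∈L′ =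
  admissible-add r (G-unforbidden-on-L′ _ _ ab∈L′ bc∈L′)

module _ {r : ℕ → ℕ → L} (M : IsFraisseLimitS r) where
  open IsFraisseLimitS M

  Y-triangle-allowed : ∀ {x y d} → x ≢ y → y ≢ d → x ≢ d →
    r x y ≡ Y → ¬ InS Y (r y d) (r x d)
  Y-triangle-allowed {x} {y} {d} x≢y y≢d x≢d xy≡Y =
    subst (λ ℓ → ¬ InS ℓ (r y d) (r x d)) xy≡Y (noForbidden x y d x≢y y≢d x≢d)

  R-inadmissible-drop : ∀ {a b c B} → InL′ (r a b) → InL′ (r b c) →
    a ≢ b → b ≢ c → a ∉ B → c ∉ B →
    ¬ Admissible r (b ∷ B) a c G → ¬ Admissible r (b ∷ B) a c R →
    ¬ Admissible r B a c R
  R-inadmissible-drop {a} {b} {c} {B} ab∈L′ bc∈L′ a≢b b≢c a∉B c∉B ¬admG ¬admR admR =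
    ¬admG (G-admissible-lift r ab∈L′ bc∈L′ admG)
    where
    b-sees-by-Y : r a b ≡ Y × r b c ≡ Y
    b-sees-by-Y = R-forbidden-on-L′ _ _ ab∈L′ bc∈L′
                    (forbidden-at-new-point r admR ¬admR)

    -- every d ∈ B forbidding G also forbids R, which admR excludes
    admG : Admissible r B a c G
    admG d d∈B forbidsG with d ≟ℕ b
    ... | yes refl = G-unforbidden-on-L′ _ _ ab∈L′ bc∈L′ forbidsG
    ... | no d≢b = admR d d∈B
          (G-forbidden⇒R-forbidden (r a d) (r d c) (r b d) abd-allowed cbd-allowed forbidsG)
      where
      b≢d : b ≢ d
      b≢d = ≢-sym d≢b
      a≢d : a ≢ d
      a≢d refl = a∉B d∈B
      c≢d : c ≢ d
      c≢d refl = c∉B d∈B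
      abd-allowed : ¬ InS Y (r b d) (r a d)
      abd-allowed = Y-triangle-allowed a≢b b≢d a≢d (proj₁ b-sees-by-Y)
      cb≡Y : r c b ≡ Y
      cb≡Y = trans (symmetric c b (≢-sym b≢c)) (proj₂ b-sees-by-Y)
      cbd-allowed : ¬ InS Y (r b d) (r d c)
      cbd-allowed = subst (λ ℓ → ¬ InS Y (r b d) ℓ) (symmetric c d c≢d)
                      (Y-triangle-allowed (≢-sym b≢c) b≢d c≢d cb≡Y)

lemma6p12 : (r : ℕ → ℕ → L) → IsFraisseLimitS r →
    (a b c : ℕ) (B : List ℕ) →
    a ≢ b → b ≢ c → InL′ (r a b) → InL′ (r b c) →
    Indep r (a ∷ []) (b ∷ B) (c ∷ []) →
    Indep r (a ∷ []) B (c ∷ [])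
lemma6p12 r M a b c B a≢b b≢c ab∈L′ bc∈L′ (disjoint , cross) =
  disjoint′ , cross′
  where
  disjoint′ : ∀ x → x ∈ a ∷ [] → x ∈ c ∷ [] → x ∈ B
  disjoint′ x (here refl) x∈c with disjoint x (here refl) x∈c
  ... | here a≡b = contradiction a≡b a≢b
  ... | there a∈B = a∈B

  cross′ : ∀ x y → x ∈ a ∷ [] → x ∉ B → y ∈ c ∷ [] → y ∉ B → IsFirstAdmissible r B x y
  cross′ x y (here refl) a∉B (here refl) c∉B =
    firstAdmissible-drop r (G-admissible-lift r ab∈L′ bc∈L′)
      (R-inadmissible-drop M ab∈L′ bc∈L′ a≢b b≢c a∉B c∉B)
      (cross a c (here refl) ([ a≢b , a∉B ]′ ∘ toSum)
                 (here refl) ([ ≢-sym b≢c , c∉B ]′ ∘ toSum))
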